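{- Let $n\geq 2$. Then the irregularity $irr(\Gamma_n)$ equals the number of ordered pairs $(e,e')\in E(\Gamma_n)^2$ such that $e'$ is an imbalanced edge for $e$.
   Context: The hypercube $Q_n$ has vertex set the binary strings of length $n$, two strings being adjacent iff they differ in exactly one position. For a binary string $x=x_1\ldots x_n$ and $i\in[1,n]$, $x+\delta_i$ denotes the string obtained from $x$ by complementing the $i$-th coordinate; the edge $\{x,x+\delta_i\}$ is said to use direction $i$. A Fibonacci string is a binary string with no two consecutive 1's; $\Gamma_n$ (Fibonacci cube) is the subgraph of $Q_n$ induced by the Fibonacci strings of length $n$. For a graph $G$, the imbalance of an edge $\{x,y\}$ is $imb_G(\{x,y\})=|d_G(x)-d_G(y)|$ and the irregularity is $irr(G)=\sum_{e\in E(G)} imb_G(e)$. For an induced subgraph $G$ of $Q_n$ and an edge $e=\{x,y\}$ of $G$ using direction $i$, the endpoint $x$ with $x_i=1$ is the upper endpoint and $y$ (with $y_i=0$) is the lower endpoint. An edge $e'=\{y,y+\delta_j\}$ of $G$ at the lower endpoint $y$ of $e$ is called an imbalanced edge for $e$ if $x+\delta_j\notin V(G)$. -}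

module Defs where

open import Data.Bool using (Bool; true; false; not)
open import Data.Bool.Properties using () renaming (_≟_ to _≟B_)
open import Data.Nat using (ℕ; zero; suc; ∣_-_∣)
open import Data.Fin using (Fin)
open import Data.Vec using (Vec; []; _∷_; lookup; updateAt)
open import Data.Vec.Properties using (≡-dec)
open import Data.List using (List; []; _∷_; _++_; map; concatMap; filter; length; allFin)
open import Data.Nat.ListAction using (sum)
open import Data.Product using (Σ; _×_; _,_; proj₁; proj₂)
open import Data.Sum using (_⊎_)
open import Relation.Nullary using (Dec; yes; no; ¬_; _×-dec_; _⊎-dec_; ¬?)
open import Relation.Binary.PropositionalEquality using (_≡_; refl)

-- Binary strings of length n (vertices of Q_n); true = 1, false = 0.
BStr : ℕ → Set
BStr n = Vec Bool n

_≟S_ : ∀ {n} (x y : BStr n) → Dec (x ≡ y)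
_≟S_ = ≡-dec _≟B_

flip : ∀ {n} → BStr n → Fin n → BStr n
flip x i = updateAt x i not

data Fib : ∀ {n} → BStr n → Set where
  fib-[] : Fib []
  fib-0  : ∀ {n} {x : BStr n} → Fib x → Fib (false ∷ x)
  fib-1[] : Fib (true ∷ [])
  fib-10 : ∀ {n} {x : BStr n} → Fib (false ∷ x) → Fib (true ∷ false ∷ x)

fib? : ∀ {n} (x : BStr n) → Dec (Fib x)
fib? [] = yes fib-[]
fib? (false ∷ x) with fib? x
... | yes p = yes (fib-0 p)
... | no ¬p = no λ { (fib-0 p) → ¬p p }
fib? (true ∷ []) = yes fib-1[]
fib? (true ∷ true ∷ x) = no λ ()
fib? (true ∷ false ∷ x) with fib? (false ∷ x)
... | yes p = yes (fib-10 p)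
... | no ¬p = no λ { (fib-10 p) → ¬p p }

allStrings : (n : ℕ) → List (BStr n)
allStrings zero = [] ∷ []
allStrings (suc n) = map (false ∷_) (allStrings n) ++ map (true ∷_) (allStrings n)

-- An edge {x, x+δ_i} of the induced subgraph Γ_n of Q_n is
-- represented (uniquely) by the pair (lower endpoint y, direction i), where
-- y_i = 0 and both y and y+δ_i are Fibonacci strings.
Edge : ℕ → Set
Edge n = BStr n × Fin n

lower : ∀ {n} → Edge n → BStr n
lower = proj₁

upper : ∀ {n} → Edge n → BStr n
upper (y , i) = flip y i

IsEdge : ∀ {n} → Edge n → Set
IsEdge (y , i) = (lookup y i ≡ false) × (Fib y × Fib (flip y i))

isEdge? : ∀ {n} (e : Edge n) → Dec (IsEdge e)
isEdge? (y , i) = (lookup y i ≟B false) ×-dec (fib? y ×-dec fib? (flip y i))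

edges : (n : ℕ) → List (Edge n)
edges n = filter isEdge? (concatMap (λ y → map (λ i → (y , i)) (allFin n)) (allStrings n))

degree : ∀ {n} → BStr n → ℕ
degree {n} x = length (filter (λ j → fib? (flip x j)) (allFin n))

imb : ∀ {n} → Edge n → ℕ
imb e = ∣ degree (upper e) - degree (lower e) ∣

irr : ℕ → ℕ
irr n = sum (map imb (edges n))

ImbalancedFor : ∀ {n} → Edge n → Edge n → Set
ImbalancedFor e (z , j) =
  ((z ≡ lower e) ⊎ (flip z j ≡ lower e)) × ¬ Fib (flip (upper e) j)

imbalancedFor? : ∀ {n} (e e' : Edge n) → Dec (ImbalancedFor e e')
imbalancedFor? e (z , j) =
  ((z ≟S lower e) ⊎-dec (flip z j ≟S lower e)) ×-dec ¬? (fib? (flip (upper e) j))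

imbalancedPairs : ℕ → ℕ
imbalancedPairs n =
  length (filter (λ p → imbalancedFor? (proj₁ p) (proj₂ p))
                 (concatMap (λ e → map (λ e' → (e , e')) (edges n)) (edges n)))

-- Let {x, y} be an edge of Γ_n with upper endpoint x = y + δ_i. If x + δ_j is a
-- Fibonacci string then so is y + δ_j, since y + δ_j is x + δ_j with the 1 in
-- position i cleared (or is x itself when j = i). Hence d(y) − d(x) is the
-- number of directions j with y + δ_j ∈ Γ_n and x + δ_j ∉ Γ_n, and j ↦ {y, y + δ_j}
-- is a bijection from these directions onto the imbalanced edges for {x, y}.
-- Summing over the edges gives the identity, for every n.
module Submission where

open import Defs
open import Data.Nat using (ℕ; _≤_)
open import Relation.Binary.PropositionalEquality using (_≡_)

open import Data.Bool using (true; false; not; if_then_else_)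
open import Data.Bool.Properties using (not-involutive)
open import Data.Nat using (zero; suc; _+_; _*_; ∣_-_∣)
open import Data.Nat.Properties using (+-assoc; +-comm; +-suc; *-identityˡ; *-distribʳ-+; ∣m-m+n∣≡n)
open import Data.Nat.ListAction using (sum)
open import Data.Nat.ListAction.Properties using (sum-++)
open import Data.Fin using (Fin) renaming (zero to fzero; suc to fsuc; _≟_ to _≟F_)
open import Data.Vec using ([]; _∷_; lookup; updateAt)
open import Data.Vec.Properties
  using (∷-injective; lookup∘updateAt; lookup∘updateAt′; updateAt-updateAt; updateAt-id-local; updateAt-commutes)
open import Data.List using (List; []; _∷_; _++_; map; concatMap; filter; length; allFin)
open import Data.List.Properties using (map-++; map-∘; map-cong; map-cong-local)
import Data.List.Relation.Unary.All as All
open import Data.List.Relation.Unary.All.Properties using (all-filter)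
open import Data.Product using (_×_; _,_; proj₁; proj₂)
open import Data.Sum using (_⊎_; inj₁; inj₂)
open import Function using (_∘_; const)
open import Function.Bundles using (_⇔_; mk⇔; Equivalence)
open import Relation.Nullary using (Dec; yes; no; ¬_; _×-dec_; ¬?; contradiction)
open import Relation.Binary.PropositionalEquality using (_≢_; refl; sym; trans; cong; cong₂; subst; module ≡-Reasoning)

open ≡-Reasoning

𝟙 : ∀ {a} {A : Set a} → Dec A → ℕ
𝟙 (yes _) = 1
𝟙 (no _)  = 0

𝟙-no : ∀ {a} {A : Set a} → ¬ A → (p : Dec A) → 𝟙 p ≡ 0
𝟙-no ¬a (yes a) = contradiction a ¬a
𝟙-no ¬a (no _)  = refl

𝟙-cong : ∀ {a b} {A : Set a} {B : Set b} → A ⇔ B → (p : Dec A) (q : Dec B) → 𝟙 p ≡ 𝟙 q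
𝟙-cong A⇔B (yes _) (yes _) = refl
𝟙-cong A⇔B (yes a) (no ¬b) = contradiction (Equivalence.to A⇔B a) ¬b
𝟙-cong A⇔B (no ¬a) (yes b) = contradiction (Equivalence.from A⇔B b) ¬a
𝟙-cong A⇔B (no _)  (no _)  = refl

𝟙-×-dec : ∀ {a b} {A : Set a} {B : Set b} (p : Dec A) (q : Dec B) → 𝟙 (p ×-dec q) ≡ 𝟙 p * 𝟙 q
𝟙-×-dec (yes _) (yes _) = refl
𝟙-×-dec (yes _) (no _)  = refl
𝟙-×-dec (no _)  _       = refl

∑ : ∀ {a} {A : Set a} → List A → (A → ℕ) → ℕ
∑ xs f = sum (map f xs)

module _ {a} {A : Set a} where

  ∑-cong : ∀ {f g : A → ℕ} → (∀ x → f x ≡ g x) → (xs : List A) → ∑ xs f ≡ ∑ xs g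
  ∑-cong f≗g xs = cong sum (map-cong f≗g xs)

  ∑-++ : (xs ys : List A) (f : A → ℕ) → ∑ (xs ++ ys) f ≡ ∑ xs f + ∑ ys f
  ∑-++ xs ys f = trans (cong sum (map-++ f xs ys)) (sum-++ (map f xs) (map f ys))

  ∑-map : ∀ {b} {B : Set b} (g : B → A) (ys : List B) (f : A → ℕ) → ∑ (map g ys) f ≡ ∑ ys (f ∘ g)
  ∑-map g ys f = cong sum (sym (map-∘ ys))

  ∑-zero : (xs : List A) → ∑ xs (λ _ → 0) ≡ 0
  ∑-zero []       = refl
  ∑-zero (_ ∷ xs) = ∑-zero xs

  ∑-+ : (xs : List A) (f g : A → ℕ) → ∑ xs (λ x → f x + g x) ≡ ∑ xs f + ∑ xs g
  ∑-+ []       f g = refl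
  ∑-+ (x ∷ xs) f g = begin
    f x + g x + ∑ xs (λ x → f x + g x) ≡⟨ cong (f x + g x +_) (∑-+ xs f g) ⟩
    f x + g x + (∑ xs f + ∑ xs g)       ≡⟨ +-assoc (f x) (g x) _ ⟩
    f x + (g x + (∑ xs f + ∑ xs g))     ≡⟨ cong (f x +_) (sym (+-assoc (g x) _ _)) ⟩
    f x + (g x + ∑ xs f + ∑ xs g)       ≡⟨ cong (λ t → f x + (t + ∑ xs g)) (+-comm (g x) _) ⟩
    f x + (∑ xs f + g x + ∑ xs g)       ≡⟨ cong (f x +_) (+-assoc (∑ xs f) _ _) ⟩
    f x + (∑ xs f + (g x + ∑ xs g))     ≡⟨ sym (+-assoc (f x) _ _) ⟩
    f x + ∑ xs f + (g x + ∑ xs g)       ∎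

  ∑-*ʳ : (xs : List A) (f : A → ℕ) (c : ℕ) → ∑ xs (λ x → f x * c) ≡ ∑ xs f * c
  ∑-*ʳ []       f c = refl
  ∑-*ʳ (x ∷ xs) f c = trans (cong (f x * c +_) (∑-*ʳ xs f c)) (sym (*-distribʳ-+ c (f x) _))

  length-filter≡∑𝟙 : ∀ {p} {P : A → Set p} (P? : ∀ x → Dec (P x)) xs →
                     length (filter P? xs) ≡ ∑ xs (𝟙 ∘ P?)
  length-filter≡∑𝟙 P? []       = refl
  length-filter≡∑𝟙 P? (x ∷ xs) with P? x
  ... | yes _ = cong suc (length-filter≡∑𝟙 P? xs)
  ... | no _  = length-filter≡∑𝟙 P? xs

  ∑𝟙-filter : ∀ {p q} {P : A → Set p} {Q : A → Set q} (P? : ∀ x → Dec (P x)) (Q? : ∀ x → Dec (Q x)) xs →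
              ∑ (filter P? xs) (𝟙 ∘ Q?) ≡ ∑ xs (λ x → 𝟙 (P? x ×-dec Q? x))
  ∑𝟙-filter P? Q? []       = refl
  ∑𝟙-filter P? Q? (x ∷ xs) with P? x
  ... | yes p = cong₂ _+_ (sym (trans (𝟙-×-dec (yes p) (Q? x)) (*-identityˡ _))) (∑𝟙-filter P? Q? xs)
  ... | no ¬p = trans (∑𝟙-filter P? Q? xs) (cong (_+ ∑ xs (λ x → 𝟙 (P? x ×-dec Q? x))) (sym (𝟙-×-dec (no ¬p) (Q? x))))

  length-filter-split : ∀ {p q} {P : A → Set p} {Q : A → Set q} (P? : ∀ x → Dec (P x)) (Q? : ∀ x → Dec (Q x)) →
                        (∀ x → P x → Q x) → (xs : List A) →
                        length (filter Q? xs) ≡ length (filter P? xs) + length (filter (λ x → Q? x ×-dec ¬? (P? x)) xs)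
  length-filter-split P? Q? P⇒Q []       = refl
  length-filter-split P? Q? P⇒Q (x ∷ xs) with Q? x | P? x
  ... | yes _ | yes _ = cong suc (length-filter-split P? Q? P⇒Q xs)
  ... | yes _ | no _  = trans (cong suc (length-filter-split P? Q? P⇒Q xs)) (sym (+-suc _ _))
  ... | no ¬q | yes p = contradiction (P⇒Q x p) ¬q
  ... | no _  | no _  = length-filter-split P? Q? P⇒Q xs

∑-comm : ∀ {a b} {A : Set a} {B : Set b} (xs : List A) (ys : List B) (f : A → B → ℕ) →
         ∑ xs (λ x → ∑ ys (f x)) ≡ ∑ ys (λ y → ∑ xs (λ x → f x y))
∑-comm []       ys f = sym (∑-zero ys)
∑-comm (x ∷ xs) ys f = trans (cong (∑ ys (f x) +_) (∑-comm xs ys f))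
                             (sym (∑-+ ys (f x) (λ y → ∑ xs (λ x → f x y))))

pairs : ∀ {a b} {A : Set a} {B : Set b} → List A → List B → List (A × B)
pairs xs ys = concatMap (λ x → map (x ,_) ys) xs

∑-pairs : ∀ {a b} {A : Set a} {B : Set b} (xs : List A) (ys : List B) (f : A × B → ℕ) →
          ∑ (pairs xs ys) f ≡ ∑ xs (λ x → ∑ ys (λ y → f (x , y)))
∑-pairs []       ys f = refl
∑-pairs (x ∷ xs) ys f = begin
  ∑ (map (x ,_) ys ++ pairs xs ys) f       ≡⟨ ∑-++ (map (x ,_) ys) (pairs xs ys) f ⟩
  ∑ (map (x ,_) ys) f + ∑ (pairs xs ys) f  ≡⟨ cong₂ _+_ (∑-map (x ,_) ys f) (∑-pairs xs ys f) ⟩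
  ∑ ys (λ y → f (x , y)) + ∑ xs (λ x → ∑ ys (λ y → f (x , y))) ∎

allStrings-unique : ∀ n (w : BStr n) → ∑ (allStrings n) (λ z → 𝟙 (z ≟S w)) ≡ 1
allStrings-unique zero    []      = refl
allStrings-unique (suc n) (b ∷ w) = begin
  ∑ (map (false ∷_) A ++ map (true ∷_) A) (λ z → 𝟙 (z ≟S (b ∷ w)))
    ≡⟨ ∑-++ (map (false ∷_) A) (map (true ∷_) A) _ ⟩
  ∑ (map (false ∷_) A) (λ z → 𝟙 (z ≟S (b ∷ w))) + ∑ (map (true ∷_) A) (λ z → 𝟙 (z ≟S (b ∷ w)))
    ≡⟨ cong₂ _+_ (∑-map (false ∷_) A _) (∑-map (true ∷_) A _) ⟩
  ∑ A (λ z → 𝟙 ((false ∷ z) ≟S (b ∷ w))) + ∑ A (λ z → 𝟙 ((true ∷ z) ≟S (b ∷ w)))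
    ≡⟨ head-split b ⟩
  1 ∎
  where
  A = allStrings n

  𝟙-∷-≟ : ∀ c z → 𝟙 ((c ∷ z) ≟S (c ∷ w)) ≡ 𝟙 (z ≟S w)
  𝟙-∷-≟ c z = 𝟙-cong (mk⇔ (proj₂ ∘ ∷-injective) (cong (c ∷_))) _ _

  𝟙-∷-≢ : ∀ c d → c ≢ d → ∀ z → 𝟙 ((c ∷ z) ≟S (d ∷ w)) ≡ 0
  𝟙-∷-≢ c d c≢d z = 𝟙-no (c≢d ∘ proj₁ ∘ ∷-injective) _

  head-split : ∀ b → ∑ A (λ z → 𝟙 ((false ∷ z) ≟S (b ∷ w))) + ∑ A (λ z → 𝟙 ((true ∷ z) ≟S (b ∷ w))) ≡ 1
  head-split false = cong₂ _+_ (trans (∑-cong (𝟙-∷-≟ false) A) (allStrings-unique n w))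
                               (trans (∑-cong (𝟙-∷-≢ true false (λ ())) A) (∑-zero A))
  head-split true  = cong₂ _+_ (trans (∑-cong (𝟙-∷-≢ false true (λ ())) A) (∑-zero A))
                               (trans (∑-cong (𝟙-∷-≟ true) A) (allStrings-unique n w))

flip-involutive : ∀ {n} (z : BStr n) (j : Fin n) → flip (flip z j) j ≡ z
flip-involutive z j = trans (updateAt-updateAt j z) (updateAt-id-local j z (not-involutive (lookup z j)))

Fib-clear : ∀ {n} {x : BStr n} → Fib x → ∀ i → Fib (updateAt x i (const false))
Fib-clear (fib-0 p)  fzero           = fib-0 p
Fib-clear (fib-0 p)  (fsuc i)        = fib-0 (Fib-clear p i)
Fib-clear fib-1[]    fzero           = fib-0 fib-[]
Fib-clear (fib-10 p) fzero           = fib-0 p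
Fib-clear (fib-10 p) (fsuc fzero)    = fib-10 p
Fib-clear (fib-10 p) (fsuc (fsuc i)) = fib-10 (Fib-clear p (fsuc i))

flip≡clear-flip-flip : ∀ {n} (y : BStr n) {i j : Fin n} → lookup y i ≡ false → i ≢ j →
                       flip y j ≡ updateAt (flip (flip y i) j) i (const false)
flip≡clear-flip-flip y {i} {j} yᵢ≡false i≢j = begin
  flip y j                                     ≡⟨ sym (updateAt-id-local i (flip y j) false≡flip-yⱼᵢ) ⟩
  updateAt (flip y j) i (const false)          ≡⟨ sym (updateAt-updateAt i (flip y j)) ⟩
  updateAt (flip (flip y j) i) i (const false) ≡⟨ cong (λ v → updateAt v i (const false)) (updateAt-commutes i j i≢j y) ⟩
  updateAt (flip (flip y i) j) i (const false) ∎
  where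
  false≡flip-yⱼᵢ : false ≡ lookup (flip y j) i
  false≡flip-yⱼᵢ = sym (trans (lookup∘updateAt′ i j i≢j y) yᵢ≡false)

Fib-flip-upper⇒Fib-flip-lower : ∀ {n} {e : Edge n} → IsEdge e → ∀ j → Fib (flip (upper e) j) → Fib (flip (lower e) j)
Fib-flip-upper⇒Fib-flip-lower {e = y , i} (yᵢ≡false , _ , Fib-x) j Fib-xⱼ with i ≟F j
... | yes refl = Fib-x
... | no i≢j   = subst Fib (sym (flip≡clear-flip-flip y yᵢ≡false i≢j)) (Fib-clear Fib-xⱼ i)

ImbalancedDirection : ∀ {n} → Edge n → Fin n → Set
ImbalancedDirection e j = Fib (flip (lower e) j) × ¬ Fib (flip (upper e) j)

imbalancedDirection? : ∀ {n} (e : Edge n) j → Dec (ImbalancedDirection e j)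
imbalancedDirection? e j = fib? (flip (lower e) j) ×-dec ¬? (fib? (flip (upper e) j))

#imbalancedDirections : ∀ {n} → Edge n → ℕ
#imbalancedDirections {n} e = length (filter (imbalancedDirection? e) (allFin n))

degree-lower : ∀ {n} {e : Edge n} → IsEdge e → degree (lower e) ≡ degree (upper e) + #imbalancedDirections e
degree-lower {n} {e} e-edge =
  length-filter-split (λ j → fib? (flip (upper e) j)) (λ j → fib? (flip (lower e) j))
                      (Fib-flip-upper⇒Fib-flip-lower e-edge) (allFin n)

imb≡#imbalancedDirections : ∀ {n} {e : Edge n} → IsEdge e → imb e ≡ #imbalancedDirections e
imb≡#imbalancedDirections {e = e} e-edge =
  trans (cong (λ d → ∣ degree (upper e) - d ∣) (degree-lower e-edge)) (∣m-m+n∣≡n (degree (upper e)) _)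

lowerEnd : ∀ {n} → BStr n → Fin n → BStr n
lowerEnd y j = if lookup y j then flip y j else y

lowerEnd-false : ∀ {n} {y : BStr n} {j} → lookup y j ≡ false → lowerEnd y j ≡ y
lowerEnd-false {y = y} {j} = cong (λ b → if b then flip y j else y)

lowerEnd-true : ∀ {n} {y : BStr n} {j} → lookup y j ≡ true → lowerEnd y j ≡ flip y j
lowerEnd-true {y = y} {j} = cong (λ b → if b then flip y j else y)

incidentEdge⇔ : ∀ {n} {y z : BStr n} {j} → Fib y →
                (IsEdge (z , j) × ((z ≡ y) ⊎ (flip z j ≡ y))) ⇔ ((z ≡ lowerEnd y j) × Fib (flip y j))
incidentEdge⇔ {y = y} {z} {j} Fib-y = mk⇔ to from
  where
  to : IsEdge (z , j) × ((z ≡ y) ⊎ (flip z j ≡ y)) → (z ≡ lowerEnd y j) × Fib (flip y j)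
  to ((zⱼ≡false , _ , Fib-zⱼ) , inj₁ refl) = sym (lowerEnd-false zⱼ≡false) , Fib-zⱼ
  to ((zⱼ≡false , Fib-z , _) , inj₂ refl) =
    sym (trans (lowerEnd-true (trans (lookup∘updateAt j z) (cong not zⱼ≡false))) (flip-involutive z j)) ,
    subst Fib (sym (flip-involutive z j)) Fib-z

  from : (z ≡ lowerEnd y j) × Fib (flip y j) → IsEdge (z , j) × ((z ≡ y) ⊎ (flip z j ≡ y))
  -- Abstracting lookup y j also evaluates the conditional inside the type of z≡.
  from (z≡ , Fib-yⱼ) with lookup y j in yⱼ
  ... | false rewrite z≡ = (yⱼ , Fib-y , Fib-yⱼ) , inj₁ refl
  ... | true  rewrite z≡ =
    (trans (lookup∘updateAt j y) (cong not yⱼ) , Fib-yⱼ , subst Fib (sym (flip-involutive y j)) Fib-y) ,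
    inj₂ (flip-involutive y j)

imbalancedFor⇔ : ∀ {n} {e : Edge n} {z j} → IsEdge e →
                 (IsEdge (z , j) × ImbalancedFor e (z , j)) ⇔ ((z ≡ lowerEnd (lower e) j) × ImbalancedDirection e j)
imbalancedFor⇔ (_ , Fib-y , _) = mk⇔
  (λ { (z-edge , incident , ¬Fib-xⱼ) → let (z≡ , Fib-yⱼ) = Equivalence.to (incidentEdge⇔ Fib-y) (z-edge , incident)
                                      in z≡ , Fib-yⱼ , ¬Fib-xⱼ })
  (λ { (z≡ , Fib-yⱼ , ¬Fib-xⱼ) → let (z-edge , incident) = Equivalence.from (incidentEdge⇔ Fib-y) (z≡ , Fib-yⱼ)
                                 in z-edge , incident , ¬Fib-xⱼ })

#imbalancedFor≡#imbalancedDirections : ∀ {n} {e : Edge n} → IsEdge e →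
  length (filter (imbalancedFor? e) (edges n)) ≡ #imbalancedDirections e
#imbalancedFor≡#imbalancedDirections {n} {e} e-edge = begin
  length (filter (imbalancedFor? e) (filter isEdge? (pairs S F)))
    ≡⟨ length-filter≡∑𝟙 (imbalancedFor? e) (filter isEdge? (pairs S F)) ⟩
  ∑ (filter isEdge? (pairs S F)) (𝟙 ∘ imbalancedFor? e)
    ≡⟨ ∑𝟙-filter isEdge? (imbalancedFor? e) (pairs S F) ⟩
  ∑ (pairs S F) (λ e′ → 𝟙 (isEdge? e′ ×-dec imbalancedFor? e e′))
    ≡⟨ ∑-pairs S F _ ⟩
  ∑ S (λ z → ∑ F (λ j → 𝟙 (isEdge? (z , j) ×-dec imbalancedFor? e (z , j))))
    ≡⟨ ∑-cong (λ z → ∑-cong (factorise z) F) S ⟩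
  ∑ S (λ z → ∑ F (λ j → 𝟙 (z ≟S lowerEnd (lower e) j) * 𝟙 (imbalancedDirection? e j)))
    ≡⟨ ∑-comm S F _ ⟩
  ∑ F (λ j → ∑ S (λ z → 𝟙 (z ≟S lowerEnd (lower e) j) * 𝟙 (imbalancedDirection? e j)))
    ≡⟨ ∑-cong (λ j → trans (∑-*ʳ S _ _) (cong (_* 𝟙 (imbalancedDirection? e j)) (allStrings-unique n (lowerEnd (lower e) j)))) F ⟩
  ∑ F (λ j → 1 * 𝟙 (imbalancedDirection? e j))
    ≡⟨ ∑-cong (λ j → *-identityˡ _) F ⟩
  ∑ F (𝟙 ∘ imbalancedDirection? e)
    ≡⟨ length-filter≡∑𝟙 (imbalancedDirection? e) F ⟨
  #imbalancedDirections e ∎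
  where
  S = allStrings n
  F = allFin n

  factorise : ∀ z j → 𝟙 (isEdge? (z , j) ×-dec imbalancedFor? e (z , j))
                    ≡ 𝟙 (z ≟S lowerEnd (lower e) j) * 𝟙 (imbalancedDirection? e j)
  factorise z j = trans (𝟙-cong (imbalancedFor⇔ e-edge) _ ((z ≟S _) ×-dec imbalancedDirection? e j))
                        (𝟙-×-dec (z ≟S _) (imbalancedDirection? e j))

length-filter-pairs : ∀ {a b r} {A : Set a} {B : Set b} {R : A × B → Set r} (R? : ∀ p → Dec (R p))
                      (xs : List A) (ys : List B) →
                      length (filter R? (pairs xs ys)) ≡ ∑ xs (λ x → length (filter (λ y → R? (x , y)) ys))
length-filter-pairs R? xs ys = begin
  length (filter R? (pairs xs ys))                  ≡⟨ length-filter≡∑𝟙 R? (pairs xs ys) ⟩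
  ∑ (pairs xs ys) (𝟙 ∘ R?)                          ≡⟨ ∑-pairs xs ys _ ⟩
  ∑ xs (λ x → ∑ ys (λ y → 𝟙 (R? (x , y))))          ≡⟨ ∑-cong (λ x → length-filter≡∑𝟙 (λ y → R? (x , y)) ys) xs ⟨
  ∑ xs (λ x → length (filter (λ y → R? (x , y)) ys)) ∎

irr≡imbalancedPairs : ∀ n → irr n ≡ imbalancedPairs n
irr≡imbalancedPairs n = begin
  ∑ (edges n) imb
    ≡⟨ cong sum (map-cong-local (All.map imb≡#imbalancedFor (all-filter isEdge? (pairs (allStrings n) (allFin n))))) ⟩
  ∑ (edges n) (λ e → length (filter (imbalancedFor? e) (edges n)))
    ≡⟨ length-filter-pairs (λ p → imbalancedFor? (proj₁ p) (proj₂ p)) (edges n) (edges n) ⟨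
  imbalancedPairs n ∎
  where
  imb≡#imbalancedFor : ∀ {e} → IsEdge e → imb e ≡ length (filter (imbalancedFor? e) (edges n))
  imb≡#imbalancedFor e-edge = trans (imb≡#imbalancedDirections e-edge) (sym (#imbalancedFor≡#imbalancedDirections e-edge))

mainTheorem1 : (n : ℕ) → 2 ≤ n → irr n ≡ imbalancedPairs n
mainTheorem1 n _ = irr≡imbalancedPairs n
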